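{- Let $(t_1,\dots,t_m)$ be a non-trivial cycle with $n$ runs and node divisors $p_1,q_1,\dots,p_n,q_n$. Then at least two of $p_1,q_1,\dots,p_n,q_n$ are equal to $1$.
   Context: The subprime Fibonacci rule: from positive integers $x,y$ with $s=x+y$, the next term is $s$ if $s$ is prime and $s/p$ if $s$ is composite, $p$ the smallest prime factor of $s$. A non-trivial cycle of length $m$ is an $m$-tuple $(t_1,\dots,t_m)$ of positive integers, indices modulo $m$, with each $t_i$ obtained from $t_{i-2},t_{i-1}$ by this rule, the $t_i$ not all equal, and $m$ the minimal period. Its signature is $s_i=(t_{i-2}+t_{i-1})/t_i$. In such a cycle every even term is followed by two odd terms; if $t_e$ is even, the pair $(a,b)=(t_{e+1},t_{e+2})$ is a node, and the run of the node is $t_{e+1}$ up to the next even term. Let the $n$ even terms of one period (the number of runs) give nodes $(a_1,b_1),\dots,(a_n,b_n)$ in cyclic order, and let $p_i$ and $q_i$ be the signature values of $a_i$ and $b_i$ respectively (the divisors). Each $p_i,q_i$ is $1$ or an odd prime, and all other signature values equal $2$. -}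

module Defs where

open import Data.Nat using (ℕ; zero; suc; _+_; _*_; _∸_; _≤_; _<_)
open import Data.Nat.DivMod using (_/_)
open import Data.Nat.Divisibility using (_∣_; _∣?_)
open import Data.Nat.Primality using (Prime; Composite)
open import Data.Nat.Properties using (_≟_)
open import Data.List using (List; []; _∷_; _++_; concatMap; upTo; filter; length)
open import Data.Product using (Σ; _×_; ∃)
open import Data.Sum using (_⊎_)
open import Relation.Binary.PropositionalEquality using (_≡_; _≢_)
open import Relation.Nullary using (¬_; yes; no)

SmallestPrimeFactor : ℕ → ℕ → Set
SmallestPrimeFactor p s = Prime p × p ∣ s × (∀ q → Prime q → q ∣ s → p ≤ q)

SubprimeStep : ℕ → ℕ → ℕ → Set
SubprimeStep x y z =
  (Prime (x + y) × z ≡ x + y)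
  ⊎ (Composite (x + y) × Σ ℕ (λ p → SmallestPrimeFactor p (x + y) × z * p ≡ x + y))

-- Total natural-number division (only ever applied to positive divisors).
divℕ : ℕ → ℕ → ℕ
divℕ n zero    = zero
divℕ n (suc k) = n / suc k

-- A non-trivial cycle of length m, represented as an m-periodic sequence
-- t : ℕ → ℕ (index i stands for the index i mod m).
record NontrivialCycle (m : ℕ) (t : ℕ → ℕ) : Set where
  field
    m-pos      : 0 < m
    positive   : ∀ i → 0 < t i
    periodic   : ∀ i → t (i + m) ≡ t i
    rule       : ∀ i → SubprimeStep (t i) (t (suc i)) (t (suc (suc i)))
    notAllEq   : Σ ℕ (λ i → Σ ℕ (λ j → t i ≢ t j))
    minimal    : ∀ k → 0 < k → k < m → ¬ (∀ i → t (i + k) ≡ t i)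

-- Signature value at index j + 2 : s_{j+2} = (t_j + t_{j+1}) / t_{j+2}.
sigAt : (ℕ → ℕ) → ℕ → ℕ
sigAt t j = divℕ (t j + t (suc j)) (t (suc (suc j)))

-- For an index e (0 ≤ e < m) with t_e even, the node (t_{e+1}, t_{e+2})
-- has divisors p = s_{e+1}, q = s_{e+2}.  (e + m ∸ 1 represents e - 1 mod m.)
nodeDivisorsAt : ℕ → (ℕ → ℕ) → ℕ → List ℕ
nodeDivisorsAt m t e with 2 ∣? t e
... | yes _ = sigAt t (e + m ∸ 1) ∷ sigAt t (e + m) ∷ []
... | no  _ = []

nodeDivisors : ℕ → (ℕ → ℕ) → List ℕ
nodeDivisors m t = concatMap (nodeDivisorsAt m t) (upTo m)

countOnes : List ℕ → ℕ
countOnes xs = length (filter (_≟ 1) xs)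

-- Along a cycle the potential t i + 2 t (i+1) of consecutive terms is unchanged
-- by a step of signature 2, drops by at least the new term at a step of
-- signature at least 3, and grows only at steps of signature 1.  The step that
-- produces the largest term has signature 1, and every signature-1 step puts a
-- 1 among the divisors of the node of whichever of its two summands is even, so
-- it suffices to find a second signature-1 step in the period.  Suppose there is
-- none and read the period from the first one.  If its node is the only one,
-- conservation of the potential makes a term divide the prime sum of the
-- signature-1 step, which is impossible.  Otherwise two consecutive divisions
-- by at least 3 at the last node give 9 F ≤ 5 J + e, where F is the potential
-- when the period closes, J the potential before that node and e its even term;
-- bounding J and e by the potential after the first node, through the node
-- before the last one or the halving run preceding it, contradicts the
-- division by at least 3 in the first node.

module Submission where

open import Data.Empty using (⊥; ⊥-elim)
open import Data.List using (List; []; _∷_; _++_; concatMap; filter; length; upTo)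
open import Data.List.Properties using (length-++; filter-++)
open import Data.List.Membership.Propositional using (_∈_)
open import Data.List.Membership.Propositional.Properties using (∈-upTo⁺)
open import Data.List.Relation.Unary.All using (lookup)
open import Data.List.Relation.Unary.Any using (here; there)
import Data.List.Extrema
open import Data.Nat
open import Data.Nat.Properties
open import Data.Nat.DivMod using (_%_; _/_; m≡m%n+[m/n]*n; m%n<n; m%n%n≡m%n; [m+n]%n≡m%n; %-distribˡ-+; n/n≡1)
open import Data.Nat.Divisibility using (_∣_; _∤_; divides; _∣?_; ∣-refl; ∣m∣n⇒∣m+n; ∣m+n∣m⇒∣n; ∣m⇒∣m*n)
open import Data.Nat.Primality using (Prime; prime[2]; prime⇒irreducible; prime⇒nonTrivial; composite⇒¬prime)
open import Data.Nat.Tactic.RingSolver using (solve)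
open import Data.Product using (∃-syntax; _×_; _,_; proj₁; proj₂)
open import Data.Sum using (_⊎_; inj₁; inj₂)
open import Relation.Binary.PropositionalEquality using (_≡_; _≢_; refl; sym; trans; cong; cong₂; subst; subst₂; module ≡-Reasoning)
open import Relation.Nullary using (¬_; yes; no; contradiction)
open import Relation.Nullary.Decidable using (decidable-stable)

open import Defs

even-or-odd : ∀ n → 2 ∣ n ⊎ ∃[ k ] n ≡ suc (k * 2)
even-or-odd zero = inj₁ (divides 0 refl)
even-or-odd (suc n) with even-or-odd n
... | inj₁ (divides k n≡k*2) = inj₂ (k , cong suc n≡k*2)
... | inj₂ (k , n≡1+k*2)     = inj₁ (divides (suc k) (cong suc n≡1+k*2))

odd+odd⇒even : ∀ {m n} → 2 ∤ m → 2 ∤ n → 2 ∣ m + n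
odd+odd⇒even m-odd n-odd with even-or-odd _ | even-or-odd _
... | inj₁ 2∣m | _        = contradiction 2∣m m-odd
... | inj₂ _   | inj₁ 2∣n = contradiction 2∣n n-odd
... | inj₂ (k , refl) | inj₂ (l , refl) = divides (suc (k + l)) (solve (k ∷ l ∷ []))

even+odd⇒odd : ∀ {m n} → 2 ∣ m → 2 ∤ n → 2 ∤ m + n
even+odd⇒odd 2∣m n-odd 2∣m+n = n-odd (∣m+n∣m⇒∣n 2∣m+n 2∣m)

odd+even⇒odd : ∀ {m n} → 2 ∤ m → 2 ∣ n → 2 ∤ m + n
odd+even⇒odd {m} {n} m-odd 2∣n = subst (2 ∤_) (+-comm n m) (even+odd⇒odd 2∣n m-odd)

double-even : ∀ n → 2 ∣ n + n
double-even n = divides n (solve (n ∷ []))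

odd-sum∧odd⇒even : ∀ {m n} → 2 ∤ m + n → 2 ∤ n → 2 ∣ m
odd-sum∧odd⇒even {m} odd n-odd with 2 ∣? m
... | yes 2∣m  = 2∣m
... | no m-odd = contradiction (odd+odd⇒even m-odd n-odd) odd

odd-sum⇒even-odd : ∀ {m n} → 2 ∤ m + n → 2 ∣ m × 2 ∤ n ⊎ 2 ∤ m × 2 ∣ n
odd-sum⇒even-odd {m} {n} odd with 2 ∣? m | 2 ∣? n
... | yes 2∣m  | yes 2∣n  = contradiction (∣m∣n⇒∣m+n 2∣m 2∣n) odd
... | yes 2∣m  | no n-odd = inj₁ (2∣m , n-odd)
... | no m-odd | yes 2∣n  = inj₂ (m-odd , 2∣n)
... | no m-odd | no n-odd = contradiction (odd+odd⇒even m-odd n-odd) odd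

interval-induction : ∀ (P : ℕ → Set) {a b} → a ≤ b → P a →
                     (∀ i → a ≤ i → i < b → P i → P (suc i)) → P b
interval-induction P {b = zero}  z≤n   pa next = pa
interval-induction P {b = suc b} a≤1+b pa next with m≤n⇒m<n∨m≡n a≤1+b
... | inj₂ refl     = pa
... | inj₁ a<1+b    = next b a≤b ≤-refl
                        (interval-induction P a≤b pa (λ i a≤i i<b → next i a≤i (m<n⇒m<1+n i<b)))
  where a≤b = s≤s⁻¹ a<1+b

prime⇒2≤ : ∀ {p} → Prime p → 2 ≤ p
prime⇒2≤ {p} p-prime = nonTrivial⇒n>1 p {{prime⇒nonTrivial p-prime}}

divisor≥2-of-prime : ∀ {d p} → Prime p → d ∣ p → 2 ≤ d → d ≡ p
divisor≥2-of-prime p-prime d∣p 2≤d with prime⇒irreducible p-prime d∣p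
... | inj₁ refl = contradiction 2≤d λ { (s≤s ()) }
... | inj₂ d≡p  = d≡p

divℕ-self : ∀ s → 0 < s → divℕ s s ≡ 1
divℕ-self (suc k) _ = n/n≡1 (suc k)

%-absorbˡ : ∀ a b d .{{_ : NonZero d}} → (a % d + b) % d ≡ (a + b) % d
%-absorbˡ a b d = begin
  (a % d + b) % d           ≡⟨ %-distribˡ-+ (a % d) b d ⟩
  (a % d % d + b % d) % d   ≡⟨ cong (λ r → (r + b % d) % d) (m%n%n≡m%n a d) ⟩
  (a % d + b % d) % d       ≡⟨ %-distribˡ-+ a b d ⟨
  (a + b) % d               ∎
  where open ≡-Reasoning

multiple-≢ : ∀ {s k} → 0 < s → 2 ≤ k → s * k ≢ s
multiple-≢ {s} {k} 0<s 2≤k eq = <-irrefl (sym eq) (m<m*n s k {{>-nonZero 0<s}} 2≤k)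

-- The potential of a pair of consecutive terms

potential : ℕ → ℕ → ℕ
potential x y = x + 2 * y

potential-halving : ∀ {x y z} → z * 2 ≡ x + y → potential y z ≡ potential x y
potential-halving {x} {y} {z} eq = begin
  y + 2 * z   ≡⟨ cong (y +_) (trans (*-comm 2 z) eq) ⟩
  y + (x + y) ≡⟨ solve (x ∷ y ∷ []) ⟩
  x + 2 * y   ∎
  where open ≡-Reasoning

potential-division : ∀ {x y z} → 3 * z ≤ x + y → potential y z + z ≤ potential x y
potential-division {x} {y} {z} 3z≤x+y = begin
  y + 2 * z + z ≡⟨ solve (y ∷ z ∷ []) ⟩
  y + 3 * z     ≤⟨ +-monoʳ-≤ y 3z≤x+y ⟩
  y + (x + y)   ≡⟨ solve (x ∷ y ∷ []) ⟩
  x + 2 * y     ∎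
  where open ≤-Reasoning

potential-double-division : ∀ {x y z w} → 3 * z ≤ x + y → 3 * w ≤ y + z →
                            9 * potential z w ≤ 5 * potential x y + y
potential-double-division {x} {y} {z} {w} 3z≤x+y 3w≤y+z = begin
  9 * (z + 2 * w)     ≡⟨ solve (z ∷ w ∷ []) ⟩
  9 * z + 6 * (3 * w) ≤⟨ +-monoʳ-≤ (9 * z) (*-monoʳ-≤ 6 3w≤y+z) ⟩
  9 * z + 6 * (y + z) ≡⟨ solve (y ∷ z ∷ []) ⟩
  5 * (3 * z) + 6 * y ≤⟨ +-monoˡ-≤ (6 * y) (*-monoʳ-≤ 5 3z≤x+y) ⟩
  5 * (x + y) + 6 * y ≡⟨ solve (x ∷ y ∷ []) ⟩
  5 * (x + 2 * y) + y ∎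
  where open ≤-Reasoning

halving-of-bounded : ∀ {x y z} → z * 2 ≡ x + y → x ≤ z → y ≤ z → x ≡ z
halving-of-bounded {x} {y} {z} eq x≤z y≤z = ≤-antisym x≤z (+-cancelʳ-≤ z z x (begin
  z + z ≡⟨ solve (z ∷ []) ⟩
  z * 2 ≡⟨ eq ⟩
  x + y ≤⟨ +-monoʳ-≤ x y≤z ⟩
  x + z ∎))
  where open ≤-Reasoning

halving-≥ : ∀ {x y z} → z * 2 ≡ x + y → y ≤ x → y ≤ z
halving-≥ {x} {y} {z} eq y≤x = *-cancelʳ-≤ y z 2 (begin
  y * 2 ≡⟨ solve (y ∷ []) ⟩
  y + y ≤⟨ +-monoˡ-≤ y y≤x ⟩
  x + y ≡⟨ eq ⟨
  z * 2 ∎)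
  where open ≤-Reasoning

3*c≤a+b⇒c≤b : ∀ {a b c} → a ≤ b → 3 * c ≤ a + b → c ≤ b
3*c≤a+b⇒c≤b {a} {b} {c} a≤b 3c≤a+b = *-cancelˡ-≤ 3 (begin
  3 * c     ≤⟨ 3c≤a+b ⟩
  a + b     ≤⟨ +-monoˡ-≤ b a≤b ⟩
  b + b     ≤⟨ m≤m+n (b + b) b ⟩
  b + b + b ≡⟨ solve (b ∷ []) ⟩
  3 * b     ∎)
  where open ≤-Reasoning

halving-≤ : ∀ {x y z B} → z * 2 ≡ x + y → x ≤ B → y ≤ B → z ≤ B
halving-≤ {x} {y} {z} {B} eq x≤B y≤B = *-cancelʳ-≤ z B 2 (begin
  z * 2 ≡⟨ eq ⟩
  x + y ≤⟨ +-mono-≤ x≤B y≤B ⟩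
  B + B ≡⟨ solve (B ∷ []) ⟩
  B * 2 ∎)
  where open ≤-Reasoning

-- The two cases of the main argument: the period reads x, y, x + y, z, … with
-- y even, or it ends with x and starts y, z, y + z, … with y even.
p≡1-closing : ∀ {x y z e} → 1 ≤ y → 3 * z ≤ y + (x + y) → 2 * e ≤ (x + y) + z →
              9 * potential x y ≤ 5 * potential (x + y) z + e → ⊥
p≡1-closing {x} {y} {z} {e} 1≤y 3z≤ 2e≤ 9F≤ = begin-contradiction
  18 * (x + y) + 7 * y              <⟨ m<m+n _ (≤-trans 1≤y (m≤m+n y (10 * y))) ⟩
  18 * (x + y) + 7 * y + (y + 10 * y) ≡⟨ solve (x ∷ y ∷ []) ⟩
  2 * (9 * (x + 2 * y))            ≤⟨ *-monoʳ-≤ 2 9F≤ ⟩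
  2 * (5 * (x + y + 2 * z) + e)    ≡⟨ solve (x ∷ y ∷ z ∷ e ∷ []) ⟩
  10 * (x + y) + 20 * z + 2 * e     ≤⟨ +-monoʳ-≤ (10 * (x + y) + 20 * z) 2e≤ ⟩
  10 * (x + y) + 20 * z + (x + y + z) ≡⟨ solve (x ∷ y ∷ z ∷ []) ⟩
  11 * (x + y) + 7 * (3 * z)        ≤⟨ +-monoʳ-≤ (11 * (x + y)) (*-monoʳ-≤ 7 3z≤) ⟩
  11 * (x + y) + 7 * (y + (x + y))  ≡⟨ solve (x ∷ y ∷ []) ⟩
  18 * (x + y) + 7 * y              ∎
  where open ≤-Reasoning

q≡1-closing : ∀ {x y z e} → 1 ≤ x → 3 * z ≤ x + y → e ≤ y + z →
              9 * potential x y ≤ 5 * potential z (y + z) + e → ⊥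
q≡1-closing {x} {y} {z} {e} 1≤x 3z≤ e≤ 9F≤ = begin-contradiction
  16 * x + 49 * y                      <⟨ m<m+n _ (≤-trans 1≤x (m≤m+n x (10 * x + 5 * y))) ⟩
  16 * x + 49 * y + (x + (10 * x + 5 * y)) ≡⟨ solve (x ∷ y ∷ []) ⟩
  3 * (9 * (x + 2 * y))               ≤⟨ *-monoʳ-≤ 3 9F≤ ⟩
  3 * (5 * (z + 2 * (y + z)) + e)     ≡⟨ solve (y ∷ z ∷ e ∷ []) ⟩
  45 * z + 30 * y + 3 * e              ≤⟨ +-monoʳ-≤ (45 * z + 30 * y) (*-monoʳ-≤ 3 e≤) ⟩
  45 * z + 30 * y + 3 * (y + z)        ≡⟨ solve (y ∷ z ∷ []) ⟩
  16 * (3 * z) + 33 * y                ≤⟨ +-monoˡ-≤ (33 * y) (*-monoʳ-≤ 16 3z≤) ⟩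
  16 * (x + y) + 33 * y                ≡⟨ solve (x ∷ y ∷ []) ⟩
  16 * x + 49 * y                      ∎
  where open ≤-Reasoning

-- With a single node, z would divide the prime x + y, respectively y + z.
p≡1-single-node : ∀ {x y z p} → Prime (x + y) → 1 ≤ x → 2 ≤ z →
                  potential x y ≡ potential (x + y) z → z * p ≡ y + (x + y) → ⊥
p≡1-single-node {x} {y} {z} {p} sum-prime 1≤x 2≤z F≡T quotient = begin-contradiction
  y                 <⟨ m<n+m y 1≤x ⟩
  x + y             ≤⟨ m≤m+n (x + y) (x + y) ⟩
  (x + y) + (x + y) ≡⟨ solve (x ∷ y ∷ []) ⟩
  2 * (x + y)       ≡⟨ cong (2 *_) z≡x+y ⟨
  2 * z             ≡⟨ y≡2z ⟨
  y                 ∎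
  where
  open ≤-Reasoning
  y≡2z : y ≡ 2 * z
  y≡2z = +-cancelˡ-≡ (x + y) y (2 * z) (trans reassociate F≡T)
    where
    reassociate : x + y + y ≡ x + 2 * y
    reassociate = solve (x ∷ y ∷ [])
  z∣x+y : z ∣ x + y
  z∣x+y = ∣m+n∣m⇒∣n (divides p (trans (sym quotient) (*-comm z p))) (divides 2 y≡2z)
  z≡x+y : z ≡ x + y
  z≡x+y = divisor≥2-of-prime sum-prime z∣x+y 2≤z

q≡1-single-node : ∀ {x y z p} → Prime (y + z) → 1 ≤ y → 2 ≤ z →
                  potential x y ≡ potential z (y + z) → z * p ≡ x + y → ⊥
q≡1-single-node {x} {y} {z} {p} sum-prime 1≤y 2≤z F≡T quotient = begin-contradiction
  z     <⟨ m<n+m z 1≤y ⟩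
  y + z ≡⟨ z≡y+z ⟨
  z     ∎
  where
  open ≤-Reasoning
  x≡3z : x ≡ 3 * z
  x≡3z = +-cancelʳ-≡ (2 * y) x (3 * z) (trans F≡T reassociate)
    where
    reassociate : z + 2 * (y + z) ≡ 3 * z + 2 * y
    reassociate = solve (y ∷ z ∷ [])
  z∣y : z ∣ y
  z∣y = ∣m+n∣m⇒∣n (divides p (trans (sym quotient) (*-comm z p))) (divides 3 x≡3z)
  z≡y+z : z ≡ y + z
  z≡y+z = divisor≥2-of-prime sum-prime (∣m∣n⇒∣m+n z∣y ∣-refl) 2≤z

-- Single steps, classified by their signature value

data Step (x y z : ℕ) : Set where
  sig≡1 : Prime (x + y) → 2 ∤ x + y → z ≡ x + y → Step x y z
  sig≡2 : z * 2 ≡ x + y → Step x y z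
  sig≥3 : 2 ∤ x + y → ∀ p → 3 ≤ p → z * p ≡ x + y → Step x y z

step-classify : ∀ {x y z} → 4 ≤ x + y → SubprimeStep x y z → Step x y z
step-classify {x} {y} 4≤s step with 2 ∣? x + y | step
... | yes 2∣s | inj₁ (sum-prime , _) with prime⇒irreducible sum-prime 2∣s
...   | inj₁ ()
...   | inj₂ 2≡s = ⊥-elim (<-irrefl 2≡s (≤-trans (s≤s (s≤s (s≤s z≤n))) 4≤s))
step-classify {x} {y} {z} 4≤s step | yes 2∣s | inj₂ (_ , p , (p-prime , _ , least) , eq) =
  sig≡2 (subst (λ q → z * q ≡ x + y) (≤-antisym (least 2 prime[2] 2∣s) (prime⇒2≤ p-prime)) eq)
step-classify 4≤s step | no odd | inj₁ (sum-prime , eq) = sig≡1 sum-prime odd eq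
step-classify 4≤s step | no odd | inj₂ (_ , p , (p-prime , p∣s , _) , eq) =
  sig≥3 odd p (≤∧≢⇒< (prime⇒2≤ p-prime) (λ { refl → odd p∣s })) eq

subprimeStep⇒2≤ : ∀ {x y z} → 0 < z → SubprimeStep x y z → 2 ≤ z
subprimeStep⇒2≤ _ (inj₁ (sum-prime , refl)) = prime⇒2≤ sum-prime
subprimeStep⇒2≤ {z = suc zero} _ (inj₂ (composite , p , (p-prime , _) , eq)) =
  ⊥-elim (composite⇒¬prime composite (subst Prime (trans (sym (+-identityʳ p)) eq) p-prime))
subprimeStep⇒2≤ {z = suc (suc _)} _ (inj₂ _) = s≤s (s≤s z≤n)

quotient-odd : ∀ {s z p} → 2 ∤ s → z * p ≡ s → 2 ∤ z
quotient-odd s-odd eq 2∣z = s-odd (subst (2 ∣_) eq (∣m⇒∣m*n _ 2∣z))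

quotient-≤ : ∀ {s z p} → 3 ≤ p → z * p ≡ s → 3 * z ≤ s
quotient-≤ {s} {z} {p} 3≤p eq = begin
  3 * z ≡⟨ *-comm 3 z ⟩
  z * 3 ≤⟨ *-monoʳ-≤ z 3≤p ⟩
  z * p ≡⟨ eq ⟩
  s     ∎
  where open ≤-Reasoning

division-of-bounded-impossible : ∀ {x y z p} → 0 < z → 3 ≤ p → z * p ≡ x + y → x ≤ z → y ≤ z → ⊥
division-of-bounded-impossible {x} {y} {z} 0<z 3≤p eq x≤z y≤z = begin-contradiction
  z + z     <⟨ m<m+n (z + z) 0<z ⟩
  z + z + z ≡⟨ solve (z ∷ []) ⟩
  3 * z     ≤⟨ quotient-≤ {z = z} 3≤p eq ⟩
  x + y     ≤⟨ +-mono-≤ x≤z y≤z ⟩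
  z + z     ∎
  where open ≤-Reasoning

halving-odd : ∀ {x y z} → z * 2 ≡ x + y → 2 ∤ y → 2 ∤ x
halving-odd {z = z} eq y-odd 2∣x = y-odd (∣m+n∣m⇒∣n (divides z (sym eq)) 2∣x)

step-even-backward : ∀ {x y z} → Step x y z → 2 ∣ y → 2 ∣ z → 2 ∣ x
step-even-backward (sig≡1 _ odd refl) _ 2∣z = contradiction 2∣z odd
step-even-backward {x} {y} {z} (sig≡2 eq) 2∣y _ =
  ∣m+n∣m⇒∣n (divides z (trans (+-comm y x) (sym eq))) 2∣y
step-even-backward (sig≥3 odd _ _ eq) _ 2∣z = contradiction 2∣z (quotient-odd odd eq)

step-equal-pair : ∀ {v z} → Step v v z → z ≡ v
step-equal-pair {v} (sig≡1 _ odd _) = contradiction (double-even v) odd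
step-equal-pair {v} {z} (sig≡2 eq) = *-cancelʳ-≡ z v 2 (trans eq (solve (v ∷ [])))
step-equal-pair {v} (sig≥3 odd _ _ _) = contradiction (double-even v) odd

step-sum : ∀ {x y} → 0 < x + y → Step x y (x + y) → Prime (x + y) × 2 ∤ x + y
step-sum _   (sig≡1 sum-prime odd _) = sum-prime , odd
step-sum pos (sig≡2 eq)              = contradiction eq (multiple-≢ pos ≤-refl)
step-sum pos (sig≥3 _ p 3≤p eq)      = contradiction eq (multiple-≢ pos (≤-trans (s≤s (s≤s z≤n)) 3≤p))

-- Periods with a single signature-1 step

module UniqueSignatureOne
  (n : ℕ) (u : ℕ → ℕ)
  (step : ∀ d → Step (u d) (u (suc d)) (u (suc (suc d))))
  (periodic : ∀ d → u (d + suc (suc n)) ≡ u d)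
  (terms-≥2 : ∀ d → 2 ≤ u d)
  (sig1-at-0 : u 2 ≡ u 0 + u 1)
  (no-other-sig1 : ∀ d → 0 < d → d < suc (suc n) → u (suc (suc d)) ≢ u d + u (suc d))
  where

  m : ℕ
  m = suc (suc n)

  J : ℕ → ℕ
  J d = potential (u d) (u (suc d))

  Halving : ℕ → Set
  Halving d = u (suc (suc d)) * 2 ≡ u d + u (suc d)

  HalvingOn : ℕ → ℕ → Set
  HalvingOn a b = ∀ i → a ≤ i → i < b → Halving i

  record Division (d : ℕ) : Set where
    field
      odd-sum   : 2 ∤ u d + u (suc d)
      divisor   : ℕ
      3≤divisor : 3 ≤ divisor
      quotient  : u (suc (suc d)) * divisor ≡ u d + u (suc d)

  division-≤ : ∀ {d} → Division d → 3 * u (suc (suc d)) ≤ u d + u (suc d)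
  division-≤ {d} div = quotient-≤ {z = u (suc (suc d))} (Division.3≤divisor div) (Division.quotient div)

  division-odd : ∀ {d} → Division d → 2 ∤ u (suc (suc d))
  division-odd {d} div = quotient-odd {z = u (suc (suc d))} (Division.odd-sum div) (Division.quotient div)

  window-step : ∀ d → 0 < d → d < m → Halving d ⊎ Division d
  window-step d 0<d d<m with step d
  ... | sig≡1 _ _ eq        = contradiction eq (no-other-sig1 d 0<d d<m)
  ... | sig≡2 eq            = inj₁ eq
  ... | sig≥3 odd p 3≤p eq  = inj₂ (record { odd-sum = odd ; divisor = p ; 3≤divisor = 3≤p ; quotient = eq })

  even-sum⇒halving : ∀ d → 0 < d → d < m → 2 ∣ u d + u (suc d) → Halving d
  even-sum⇒halving d 0<d d<m even with window-step d 0<d d<m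
  ... | inj₁ halving = halving
  ... | inj₂ div     = contradiction even (Division.odd-sum div)

  odd-sum⇒division : ∀ d → 0 < d → d < m → 2 ∤ u d + u (suc d) → Division d
  odd-sum⇒division d 0<d d<m odd with window-step d 0<d d<m
  ... | inj₁ halving = contradiction (divides (u (suc (suc d))) (sym halving)) odd
  ... | inj₂ div     = div

  u2-prime-odd : Prime (u 2) × 2 ∤ u 2
  u2-prime-odd = subst (λ s → Prime s × 2 ∤ s) (sym sig1-at-0)
    (step-sum (≤-trans (s≤s z≤n) (≤-trans (terms-≥2 0) (m≤m+n (u 0) (u 1))))
              (subst (Step (u 0) (u 1)) sig1-at-0 (step 0)))

  u2-odd : 2 ∤ u 2
  u2-odd = proj₂ u2-prime-odd

  no-even-pair : ∀ k → 2 ∣ u k → 2 ∣ u (suc k) → ⊥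
  no-even-pair zero    e₀ e₁ = u2-odd (subst (2 ∣_) (sym sig1-at-0) (∣m∣n⇒∣m+n e₀ e₁))
  no-even-pair (suc k) e₁ e₂ = no-even-pair k (step-even-backward (step k) e₁ e₂) e₁

  J-halving : ∀ {d} → Halving d → J (suc d) ≡ J d
  J-halving {d} = potential-halving {u d} {u (suc d)} {u (suc (suc d))}

  J-division : ∀ {d} → Division d → J (suc d) + u (suc (suc d)) ≤ J d
  J-division {d} div = potential-division {u d} {u (suc d)} {u (suc (suc d))} (division-≤ div)

  J-constant : ∀ {a b} → a ≤ b → HalvingOn a b → J b ≡ J a
  J-constant {a} a≤b halving =
    interval-induction (λ i → J i ≡ J a) a≤b refl
      (λ i a≤i i<b J≡ → trans (J-halving (halving i a≤i i<b)) J≡)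

  J-antitone : ∀ {a b} → 1 ≤ a → a ≤ b → b ≤ m → J b ≤ J a
  J-antitone {a} {b} 1≤a a≤b b≤m =
    interval-induction (λ i → J i ≤ J a) a≤b ≤-refl next
    where
    next : ∀ i → a ≤ i → i < b → J i ≤ J a → J (suc i) ≤ J a
    next i a≤i i<b J≤ with window-step i (≤-trans 1≤a a≤i) (<-≤-trans i<b b≤m)
    ... | inj₁ halving = ≤-trans (≤-reflexive (J-halving halving)) J≤
    ... | inj₂ div     = ≤-trans (≤-trans (m≤m+n _ _) (J-division div)) J≤

  halving-bound : ∀ {a b B} → a ≤ b → HalvingOn a b → u a ≤ B → u (suc a) ≤ B → u (suc b) ≤ B
  halving-bound {a} {b} {B} a≤b halving ua≤B ua+1≤B =
    proj₂ (interval-induction (λ i → u i ≤ B × u (suc i) ≤ B) a≤b (ua≤B , ua+1≤B)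
      (λ i a≤i i<b (ui≤B , ui+1≤B) → ui+1≤B , halving-≤ (halving i a≤i i<b) ui≤B ui+1≤B))

  halving-extend : ∀ {a b} → HalvingOn a b → Halving b → HalvingOn a (suc b)
  halving-extend halving h i a≤i i<1+b with m≤n⇒m<n∨m≡n (s≤s⁻¹ i<1+b)
  ... | inj₁ i<b  = halving i a≤i i<b
  ... | inj₂ refl = h

  last-division : ∀ b → b ≤ m →
    HalvingOn 2 b ⊎ ∃[ c ] 2 ≤ c × c < b × Division c × HalvingOn (suc c) b
  last-division zero    _   = inj₁ (λ _ _ ())
  last-division (suc b) b<m with 2 ≤? b
  ... | no b≱2 = inj₁ (λ i 2≤i i<1+b → ⊥-elim (b≱2 (≤-trans 2≤i (s≤s⁻¹ i<1+b))))
  ... | yes 2≤b with window-step b (≤-trans (s≤s z≤n) 2≤b) b<m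
  ...   | inj₂ div = inj₂ (b , 2≤b , ≤-refl , div , λ i b<i i<1+b → contradiction (s≤s⁻¹ i<1+b) (<⇒≱ b<i))
  ...   | inj₁ h with last-division b (<⇒≤ b<m)
  ...     | inj₁ halving = inj₁ (halving-extend halving h)
  ...     | inj₂ (c , 2≤c , c<b , div , halving) =
              inj₂ (c , 2≤c , m<n⇒m<1+n c<b , div , halving-extend halving h)

  halving-prepend : ∀ {a b} → Halving a → HalvingOn (suc a) b → HalvingOn a b
  halving-prepend h halving i a≤i i<b with m≤n⇒m<n∨m≡n a≤i
  ... | inj₁ a<i  = halving i a<i i<b
  ... | inj₂ refl = h

  record Node (hi : ℕ) : Set where
    field
      k             : ℕ
      2≤k           : 2 ≤ k
      k+2≤hi        : suc (suc k) ≤ hi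
      first         : Division k
      second        : Division (suc k)
      even          : 2 ∣ u (suc k)
      halving-after : HalvingOn (suc (suc k)) hi

    k≤hi : k ≤ hi
    k≤hi = ≤-trans (m≤n+m k 2) k+2≤hi

  second-division-of-node : ∀ k → 1 ≤ k → suc k < m → Division (suc k) → 2 ∤ u (suc (suc k)) →
                  2 ≤ k × Division k × 2 ∣ u (suc k)
  second-division-of-node (suc zero) _ _ div odd =
    contradiction (odd-sum∧odd⇒even (Division.odd-sum div) odd) u2-odd
  second-division-of-node k@(suc (suc _)) _ k+1<m div odd =
    s≤s (s≤s z≤n) , odd-sum⇒division k (s≤s z≤n) (<-trans (n<1+n k) k+1<m) (odd+even⇒odd uk-odd even) , even
    where
    even : 2 ∣ u (suc k)
    even = odd-sum∧odd⇒even (Division.odd-sum div) odd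
    uk-odd : 2 ∤ u k
    uk-odd uk-even = no-even-pair k uk-even even

  odd-after-last-division : ∀ {j hi} → Division j → suc j ≤ hi → HalvingOn (suc j) hi →
                            2 ∤ u hi ⊎ 2 ∣ u (suc hi) → 2 ∤ u (suc j)
  odd-after-last-division {j} div j<hi halving end with m≤n⇒m<n∨m≡n j<hi
  ... | inj₁ j+1<hi = halving-odd {z = u (suc (suc (suc j)))} (halving (suc j) ≤-refl j+1<hi) (division-odd div)
  ... | inj₂ refl with end
  ...   | inj₁ odd  = odd
  ...   | inj₂ even = contradiction even (division-odd div)

  last-node : ∀ hi → hi ≤ m → 2 ∤ u hi ⊎ 2 ∣ u (suc hi) → HalvingOn 2 hi ⊎ Node hi
  last-node hi hi≤m end with last-division hi hi≤m
  ... | inj₁ halving = inj₁ halving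
  ... | inj₂ (suc k , s≤s 1≤k , k+1<hi , div , halving)
    with second-division-of-node k 1≤k (<-≤-trans k+1<hi hi≤m) div (odd-after-last-division div k+1<hi halving end)
  ...   | 2≤k , div-k , even = inj₂ (record
          { k = k ; 2≤k = 2≤k ; k+2≤hi = k+1<hi ; first = div-k ; second = div
          ; even = even ; halving-after = halving })

  node-potential : ∀ {hi} (N : Node hi) → 9 * J hi ≤ 5 * J (Node.k N) + u (suc (Node.k N))
  node-potential {hi} N = begin
    9 * J hi            ≡⟨ cong (9 *_) (J-constant k+2≤hi halving-after) ⟩
    9 * J (suc (suc k)) ≤⟨ potential-double-division {u k} {u (suc k)} {u (suc (suc k))} {u (suc (suc (suc k)))}
                             (division-≤ first) (division-≤ second) ⟩
    5 * J k + u (suc k) ∎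
    where
    open Node N
    open ≤-Reasoning

  node-bound : ∀ {hi} (N : Node hi) → hi ≤ m → 5 * J hi + u (suc hi) ≤ 5 * J 2
  node-bound {hi} N hi≤m = begin
    5 * J hi + u (suc hi) ≤⟨ +-monoʳ-≤ (5 * J hi) (≤-trans next≤S (m≤n*m S 5)) ⟩
    5 * J hi + 5 * S      ≡⟨ *-distribˡ-+ 5 (J hi) S ⟨
    5 * (J hi + S)        ≤⟨ *-monoʳ-≤ 5 drop ⟩
    5 * J k               ≤⟨ *-monoʳ-≤ 5 (J-antitone (s≤s z≤n) 2≤k (≤-trans k≤hi hi≤m)) ⟩
    5 * J 2               ∎
    where
    open Node N
    open ≤-Reasoning
    S : ℕ
    S = u (suc (suc (suc k))) + u (suc (suc k))
    next≤S : u (suc hi) ≤ S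
    next≤S = halving-bound k+2≤hi halving-after (m≤n+m _ _) (m≤m+n _ _)
    drop : J hi + S ≤ J k
    drop = begin
      J hi + S                                              ≡⟨ cong (_+ S) (J-constant k+2≤hi halving-after) ⟩
      J (suc (suc k)) + S                                   ≡⟨ +-assoc (J (suc (suc k))) _ _ ⟨
      J (suc (suc k)) + u (suc (suc (suc k))) + u (suc (suc k)) ≤⟨ +-monoˡ-≤ _ (J-division second) ⟩
      J (suc k) + u (suc (suc k))                           ≤⟨ J-division first ⟩
      J k                                                   ∎

  -- Classified by the nodes whose divisions are among the steps 2, …, hi − 1.
  data Window (hi : ℕ) : Set where
    no-node       : HalvingOn 2 hi → Window hi
    one-node      : ∀ k → 2 ≤ k → 2 ∣ u (suc k) → HalvingOn 2 k →
                    9 * J hi ≤ 5 * J 2 + u (suc k) → Window hi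
    several-nodes : 9 * J hi ≤ 5 * J 2 → Window hi

  -- The end condition makes the last division before hi the second one of a node.
  window : ∀ hi → hi ≤ m → 2 ∤ u hi ⊎ 2 ∣ u (suc hi) → Window hi
  window hi hi≤m end with last-node hi hi≤m end
  ... | inj₁ halving = no-node halving
  ... | inj₂ N with last-node (Node.k N) (≤-trans (Node.k≤hi N) hi≤m) (inj₂ (Node.even N))
  ...   | inj₁ halving = one-node (Node.k N) (Node.2≤k N) (Node.even N) halving
            (subst (λ J₂ → 9 * J hi ≤ 5 * J₂ + u (suc (Node.k N)))
                   (J-constant (Node.2≤k N) halving) (node-potential N))
  ...   | inj₂ N′ = several-nodes (≤-trans (node-potential N) (node-bound N′ (≤-trans (Node.k≤hi N) hi≤m)))

  terms-≥1 : ∀ d → 1 ≤ u d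
  terms-≥1 d = ≤-trans (s≤s z≤n) (terms-≥2 d)

  module SignatureOneAsP (u1-even : 2 ∣ u 1) where

    q-step : Division 1
    q-step = odd-sum⇒division 1 (s≤s z≤n) (s≤s (s≤s z≤n)) (even+odd⇒odd u1-even u2-odd)

    q-step-≤ : 3 * u 3 ≤ u 1 + (u 0 + u 1)
    q-step-≤ = subst (λ s → 3 * u 3 ≤ u 1 + s) sig1-at-0 (division-≤ q-step)

    J-end : J m ≡ potential (u 0) (u 1)
    J-end = cong₂ potential (periodic 0) (periodic 1)

    J-start : J 2 ≡ potential (u 0 + u 1) (u 3)
    J-start = cong (λ s → potential s (u 3)) sig1-at-0

    closing : ∀ e → 2 * e ≤ (u 0 + u 1) + u 3 → 9 * J m ≤ 5 * J 2 + e → ⊥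
    closing e 2e≤ bound = p≡1-closing (terms-≥1 1) q-step-≤ 2e≤
      (subst₂ (λ F T → 9 * F ≤ 5 * T + e) J-end J-start bound)

    no-node-impossible : HalvingOn 2 m → ⊥
    no-node-impossible halving =
      p≡1-single-node (subst Prime sig1-at-0 (proj₁ u2-prime-odd)) (terms-≥1 0) (terms-≥2 3)
        (trans (sym J-end) (trans (J-constant (s≤s (s≤s z≤n)) halving) J-start))
        (subst (λ s → u 3 * Division.divisor q-step ≡ u 1 + s) sig1-at-0 (Division.quotient q-step))

    one-node-bound : ∀ k → 2 ≤ k → 2 ∣ u (suc k) → HalvingOn 2 k → 2 * u (suc k) ≤ (u 0 + u 1) + u 3
    one-node-bound zero          ()          _       _
    one-node-bound (suc zero)    (s≤s ())    _       _
    one-node-bound (suc (suc zero)) _ u3-even _ = contradiction u3-even (division-odd q-step)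
    one-node-bound k@(suc (suc (suc _))) _ _ halving = begin
      2 * u (suc k) ≤⟨ *-monoʳ-≤ 2 (halving-bound (s≤s (s≤s (s≤s z≤n))) (λ i 3≤i → halving i (<⇒≤ 3≤i))
                                                  u3≤u4 ≤-refl) ⟩
      2 * u 4       ≡⟨ *-comm 2 (u 4) ⟩
      u 4 * 2       ≡⟨ halving-2 ⟩
      u 2 + u 3     ≡⟨ cong (_+ u 3) sig1-at-0 ⟩
      (u 0 + u 1) + u 3 ∎
      where
      open ≤-Reasoning
      halving-2 : Halving 2
      halving-2 = halving 2 ≤-refl (s≤s (s≤s (s≤s z≤n)))
      u3≤u4 : u 3 ≤ u 4
      u3≤u4 = halving-≥ halving-2
                (3*c≤a+b⇒c≤b (subst (u 1 ≤_) (sym sig1-at-0) (m≤n+m (u 1) (u 0))) (division-≤ q-step))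

    impossible : ⊥
    impossible with window m ≤-refl (inj₂ (subst (2 ∣_) (sym (periodic 1)) u1-even))
    ... | no-node halving = no-node-impossible halving
    ... | one-node k 2≤k even halving bound = closing (u (suc k)) (one-node-bound k 2≤k even halving) bound
    ... | several-nodes bound = closing 0 z≤n (subst (9 * J m ≤_) (sym (+-identityʳ _)) bound)

  module SignatureOneAsQ (u0-even : 2 ∣ u 0) (u1-odd : 2 ∤ u 1) where

    halving-1 : Halving 1
    halving-1 = even-sum⇒halving 1 (s≤s z≤n) (s≤s (s≤s z≤n)) (odd+odd⇒even u1-odd u2-odd)

    um-even : 2 ∣ u m
    um-even = subst (2 ∣_) (sym (periodic 0)) u0-even

    before-end-odd : 2 ∤ u (suc n)
    before-end-odd even = no-even-pair (suc n) even um-even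

    p-step : Division (suc n)
    p-step = odd-sum⇒division (suc n) (s≤s z≤n) ≤-refl (odd+even⇒odd before-end-odd um-even)

    p-step-≤ : 3 * u 1 ≤ u (suc n) + u 0
    p-step-≤ = subst₂ (λ a b → 3 * a ≤ u (suc n) + b) (periodic 1) (periodic 0) (division-≤ p-step)

    J-end : J (suc n) ≡ potential (u (suc n)) (u 0)
    J-end = cong (potential (u (suc n))) (periodic 0)

    J-start : J 2 ≡ potential (u 1) (u 0 + u 1)
    J-start = trans (J-halving halving-1) (cong (potential (u 1)) sig1-at-0)

    period≥3 : 1 ≤ n
    period≥3 = n≢0⇒n>0 λ n≡0 →
      <-irrefl (sym (u2≡u0 n≡0)) (subst (u 0 <_) (sym sig1-at-0) (m<m+n (u 0) (terms-≥1 1)))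
      where
      u2≡u0 : n ≡ 0 → u 2 ≡ u 0
      u2≡u0 n≡0 = subst (λ k → u (suc (suc k)) ≡ u 0) n≡0 (periodic 0)

    closing : ∀ e → e ≤ u 0 + u 1 → 9 * J (suc n) ≤ 5 * J 2 + e → ⊥
    closing e e≤ bound = q≡1-closing (terms-≥1 (suc n)) p-step-≤ e≤
      (subst₂ (λ F T → 9 * F ≤ 5 * T + e) J-end J-start bound)

    no-node-impossible : HalvingOn 2 (suc n) → ⊥
    no-node-impossible halving =
      q≡1-single-node (subst Prime sig1-at-0 (proj₁ u2-prime-odd)) (terms-≥1 0) (terms-≥2 1)
        (trans (sym J-end) (trans (J-constant (s≤s period≥3) halving) J-start))
        (subst₂ (λ a b → a * Division.divisor p-step ≡ u (suc n) + b) (periodic 1) (periodic 0)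
                (Division.quotient p-step))

    one-node-bound : ∀ k → 1 ≤ k → HalvingOn 2 k → u (suc k) ≤ u 0 + u 1
    one-node-bound k 1≤k halving = subst (u (suc k) ≤_) sig1-at-0
      (halving-bound 1≤k (halving-prepend halving-1 halving)
        (subst (u 1 ≤_) (sym sig1-at-0) (m≤n+m (u 1) (u 0))) ≤-refl)

    impossible : ⊥
    impossible with window (suc n) (n≤1+n (suc n)) (inj₁ before-end-odd)
    ... | no-node halving = no-node-impossible halving
    ... | one-node k 2≤k _ halving bound =
            closing (u (suc k)) (one-node-bound k (≤-trans (s≤s z≤n) 2≤k) halving) bound
    ... | several-nodes bound = closing 0 z≤n (subst (9 * J (suc n) ≤_) (sym (+-identityʳ _)) bound)

  impossible : ⊥
  impossible with 2 ∣? u 1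
  ... | yes u1-even = SignatureOneAsP.impossible u1-even
  ... | no u1-odd   = SignatureOneAsQ.impossible
                        (odd-sum∧odd⇒even (subst (2 ∤_) sig1-at-0 u2-odd) u1-odd) u1-odd

countOnes-++ : ∀ xs ys → countOnes (xs ++ ys) ≡ countOnes xs + countOnes ys
countOnes-++ xs ys = trans (cong length (filter-++ (_≟ 1) xs ys)) (length-++ (filter (_≟ 1) xs))

countOnes-p∷1 : ∀ p → 1 ≤ countOnes (p ∷ 1 ∷ [])
countOnes-p∷1 p = ≤-trans (m≤n+m 1 (countOnes (p ∷ []))) (≤-reflexive (sym (countOnes-++ (p ∷ []) (1 ∷ []))))

module _ (g : ℕ → List ℕ) where

  ≤-countOnes-concatMap-∷ : ∀ {a} x xs → a ≤ countOnes (g x) + countOnes (concatMap g xs) →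
                            a ≤ countOnes (concatMap g (x ∷ xs))
  ≤-countOnes-concatMap-∷ {a} x xs = subst (a ≤_) (sym (countOnes-++ (g x) (concatMap g xs)))

  countOnes-concatMap-∈ : ∀ {e xs} → e ∈ xs → countOnes (g e) ≤ countOnes (concatMap g xs)
  countOnes-concatMap-∈ {xs = x ∷ xs} (here refl)  = ≤-countOnes-concatMap-∷ x xs (m≤m+n _ _)
  countOnes-concatMap-∈ {xs = x ∷ xs} (there e∈xs) =
    ≤-countOnes-concatMap-∷ x xs (≤-trans (countOnes-concatMap-∈ e∈xs) (m≤n+m _ _))

  countOnes-concatMap-∈₂ : ∀ {e₁ e₂ xs} → e₁ ∈ xs → e₂ ∈ xs → e₁ ≢ e₂ →
                           countOnes (g e₁) + countOnes (g e₂) ≤ countOnes (concatMap g xs)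
  countOnes-concatMap-∈₂ (here refl) (here refl) e₁≢e₂ = contradiction refl e₁≢e₂
  countOnes-concatMap-∈₂ {xs = x ∷ xs} (here refl) (there e₂∈xs) _ =
    ≤-countOnes-concatMap-∷ x xs (+-monoʳ-≤ _ (countOnes-concatMap-∈ e₂∈xs))
  countOnes-concatMap-∈₂ {e₁} {e₂} {x ∷ xs} (there e₁∈xs) (here refl) _ =
    ≤-countOnes-concatMap-∷ x xs
      (subst (_≤ countOnes (g x) + countOnes (concatMap g xs)) (+-comm (countOnes (g e₂)) (countOnes (g e₁)))
             (+-monoʳ-≤ _ (countOnes-concatMap-∈ e₁∈xs)))
  countOnes-concatMap-∈₂ {xs = x ∷ xs} (there e₁∈xs) (there e₂∈xs) e₁≢e₂ =
    ≤-countOnes-concatMap-∷ x xs (≤-trans (countOnes-concatMap-∈₂ e₁∈xs e₂∈xs e₁≢e₂) (m≤n+m _ _))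

-- Cycles of period at least 2

module Cycle (n : ℕ) (t : ℕ → ℕ) (C : NontrivialCycle (suc (suc n)) t) where
  open NontrivialCycle C

  m : ℕ
  m = suc (suc n)

  periodic-* : ∀ k i → t (i + k * m) ≡ t i
  periodic-* zero    i = cong t (+-identityʳ i)
  periodic-* (suc k) i = begin
    t (i + (m + k * m)) ≡⟨ cong (λ j → t (i + j)) (+-comm m (k * m)) ⟩
    t (i + (k * m + m)) ≡⟨ cong t (+-assoc i (k * m) m) ⟨
    t (i + k * m + m)   ≡⟨ periodic (i + k * m) ⟩
    t (i + k * m)       ≡⟨ periodic-* k i ⟩
    t i                 ∎
    where open ≡-Reasoning

  t-% : ∀ i → t i ≡ t (i % m)
  t-% i = trans (cong t (m≡m%n+[m/n]*n i m)) (periodic-* (i / m) (i % m))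

  residue-∈ : ∀ i → i % m ∈ upTo m
  residue-∈ i = ∈-upTo⁺ (m%n<n i m)

  t-%-cong : ∀ {i j} → i % m ≡ j % m → ∀ d → t (d + i) ≡ t (d + j)
  t-%-cong {i} {j} i≡j d = begin
    t (d + i)                   ≡⟨ t-% (d + i) ⟩
    t ((d + i) % m)             ≡⟨ cong t (%-distribˡ-+ d i m) ⟩
    t ((d % m + i % m) % m)     ≡⟨ cong (λ r → t ((d % m + r) % m)) i≡j ⟩
    t ((d % m + j % m) % m)     ≡⟨ cong t (%-distribˡ-+ d j m) ⟨
    t ((d + j) % m)             ≡⟨ t-% (d + j) ⟨
    t (d + j)                   ∎
    where open ≡-Reasoning

  t-2+ : ∀ i → t (suc (suc (i + n))) ≡ t i
  t-2+ i = trans (cong t (sym (trans (+-suc i (suc n)) (cong suc (+-suc i n))))) (periodic i)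

  terms-≥2 : ∀ i → 2 ≤ t i
  terms-≥2 i = subst (2 ≤_) (t-2+ i) (subprimeStep⇒2≤ {t (i + n)} {t (suc (i + n))} (positive _) (rule (i + n)))

  steps : ∀ i → Step (t i) (t (suc i)) (t (suc (suc i)))
  steps i = step-classify (+-mono-≤ (terms-≥2 i) (terms-≥2 (suc i))) (rule i)

  constant-pair-impossible : ∀ k v → t k ≡ v → t (suc k) ≡ v → ⊥
  constant-pair-impossible k v tₖ≡v tₖ₊₁≡v with notAllEq
  ... | i , j , tᵢ≢tⱼ = tᵢ≢tⱼ (trans (all≡v i) (sym (all≡v j)))
    where
    from-k : ∀ d → t (d + k) ≡ v × t (suc d + k) ≡ v
    from-k zero    = tₖ≡v , tₖ₊₁≡v
    from-k (suc d) with from-k d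
    ... | e , e′ = e′ , step-equal-pair (subst₂ (λ a b → Step a b (t (suc (suc d) + k))) e e′ (steps (d + k)))
    all≡v : ∀ i → t i ≡ v
    all≡v i = trans (sym (periodic-* k i))
      (trans (cong t (sym (m∸n+n≡m k≤i+km))) (proj₁ (from-k (i + k * m ∸ k))))
      where
      k≤i+km : k ≤ i + k * m
      k≤i+km = ≤-trans (m≤m*n k m) (m≤n+m (k * m) i)

  sum-pos : ∀ r → 0 < t r + t (suc r)
  sum-pos r = ≤-trans (s≤s z≤n) (≤-trans (terms-≥2 r) (m≤m+n _ _))

  Sig1 : ℕ → Set
  Sig1 r = t (suc (suc r)) ≡ t r + t (suc r)

  sig1-sum-odd : ∀ r → Sig1 r → 2 ∤ t r + t (suc r)
  sig1-sum-odd r sig1 = proj₂ (step-sum (sum-pos r) (subst (Step (t r) (t (suc r))) sig1 (steps r)))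

  open Data.List.Extrema ≤-totalOrder using (argmax; f[xs]≤f[argmax])

  maximal-output : ∃[ r ] ∀ i → t i ≤ t (suc (suc r))
  maximal-output = top + n , λ i → subst (t i ≤_) (sym (t-2+ top)) (≤top i)
    where
    top : ℕ
    top = argmax t 0 (upTo m)
    ≤top : ∀ i → t i ≤ t top
    ≤top i = subst (_≤ t top) (sym (t-% i)) (lookup (f[xs]≤f[argmax] {f = t} 0 (upTo m)) (residue-∈ i))

  maximal-output⇒sig1 : ∀ r → (∀ i → t i ≤ t (suc (suc r))) → Sig1 r
  maximal-output⇒sig1 r ≤max with steps r
  ... | sig≡1 _ _ eq = eq
  ... | sig≡2 eq = ⊥-elim (constant-pair-impossible r (t (suc (suc r)))
                     (halving-of-bounded eq (≤max r) (≤max (suc r)))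
                     (halving-of-bounded (trans eq (+-comm (t r) _)) (≤max (suc r)) (≤max r)))
  ... | sig≥3 _ p 3≤p eq = ⊥-elim (division-of-bounded-impossible {z = t (suc (suc r))}
                             (≤-trans (s≤s z≤n) (terms-≥2 _)) 3≤p eq (≤max r) (≤max (suc r)))

  g : ℕ → List ℕ
  g = nodeDivisorsAt m t

  node-divisors-at-even : ∀ e → 2 ∣ t e → g e ≡ sigAt t (e + m ∸ 1) ∷ sigAt t (e + m) ∷ []
  node-divisors-at-even e even with 2 ∣? t e
  ... | yes _  = refl
  ... | no odd = contradiction even odd

  sigAt-%-cong : ∀ {i j} → i % m ≡ j % m → sigAt t i ≡ sigAt t j
  sigAt-%-cong i≡j = cong₂ divℕ (cong₂ _+_ (t-%-cong i≡j 0) (t-%-cong i≡j 1)) (t-%-cong i≡j 2)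

  sig1⇒sigAt≡1 : ∀ {r} → Sig1 r → sigAt t r ≡ 1
  sig1⇒sigAt≡1 {r} sig1 = trans (cong (divℕ (t r + t (suc r))) sig1) (divℕ-self _ (sum-pos r))

  [r%m+m]%m≡r%m : ∀ r → (r % m + m) % m ≡ r % m
  [r%m+m]%m≡r%m r = trans ([m+n]%n≡m%n (r % m) m) (m%n%n≡m%n r m)

  [[1+r]%m+m∸1]%m≡r%m : ∀ r → (suc r % m + m ∸ 1) % m ≡ r % m
  [[1+r]%m+m∸1]%m≡r%m r = begin
    (suc r % m + m ∸ 1) % m ≡⟨ cong (λ a → (a ∸ 1) % m) (+-suc (suc r % m) (suc n)) ⟩
    (suc r % m + suc n) % m ≡⟨ %-absorbˡ (suc r) (suc n) m ⟩
    (suc r + suc n) % m     ≡⟨ cong (_% m) (sym (+-suc r (suc n))) ⟩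
    (r + m) % m             ≡⟨ [m+n]%n≡m%n r m ⟩
    r % m                   ∎
    where open ≡-Reasoning

  sig1-is-q : ∀ r → Sig1 r → 2 ∣ t r → ∃[ p ] g (r % m) ≡ p ∷ 1 ∷ []
  sig1-is-q r sig1 tr-even = sigAt t (r % m + m ∸ 1) , (begin
    g e                                        ≡⟨ node-divisors-at-even e (subst (2 ∣_) (t-% r) tr-even) ⟩
    sigAt t (e + m ∸ 1) ∷ sigAt t (e + m) ∷ [] ≡⟨ cong (λ q → sigAt t (e + m ∸ 1) ∷ q ∷ []) q≡1 ⟩
    sigAt t (e + m ∸ 1) ∷ 1 ∷ []               ∎)
    where
    open ≡-Reasoning
    e : ℕ
    e = r % m
    q≡1 : sigAt t (r % m + m) ≡ 1
    q≡1 = trans (sigAt-%-cong ([r%m+m]%m≡r%m r)) (sig1⇒sigAt≡1 sig1)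

  sig1-is-p : ∀ r → Sig1 r → 2 ∣ t (suc r) → ∃[ q ] g (suc r % m) ≡ 1 ∷ q ∷ []
  sig1-is-p r sig1 tr+1-even = sigAt t (e + m) , (begin
    g e                                       ≡⟨ node-divisors-at-even e (subst (2 ∣_) (t-% (suc r)) tr+1-even) ⟩
    sigAt t (e + m ∸ 1) ∷ sigAt t (e + m) ∷ [] ≡⟨ cong (λ p → p ∷ sigAt t (e + m) ∷ []) p≡1 ⟩
    1 ∷ sigAt t (e + m) ∷ []                  ∎)
    where
    open ≡-Reasoning
    e : ℕ
    e = suc r % m
    p≡1 : sigAt t (e + m ∸ 1) ≡ 1
    p≡1 = trans (sigAt-%-cong ([[1+r]%m+m∸1]%m≡r%m r)) (sig1⇒sigAt≡1 sig1)

  sig1-node-divisor : ∀ r → Sig1 r →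
    (∃[ p ] g (r % m) ≡ p ∷ 1 ∷ []) ⊎ (∃[ q ] g (suc r % m) ≡ 1 ∷ q ∷ [])
  sig1-node-divisor r sig1 with odd-sum⇒even-odd (sig1-sum-odd r sig1)
  ... | inj₁ (tr-even , _)   = inj₁ (sig1-is-q r sig1 tr-even)
  ... | inj₂ (_ , tr+1-even) = inj₂ (sig1-is-p r sig1 tr+1-even)

  distinct-residues : ∀ {a b} → a < b → b < a + m → a % m ≢ b % m
  distinct-residues {a} {b} a<b b<a+m a≡b = begin-contradiction
    b                    <⟨ b<a+m ⟩
    a + m                ≡⟨ cong (_+ m) a-split ⟩
    ρ + a / m * m + m    ≡⟨ trans (+-assoc ρ (a / m * m) m) (cong (ρ +_) (+-comm (a / m * m) m)) ⟩
    ρ + suc (a / m) * m  ≤⟨ +-monoʳ-≤ ρ (*-monoˡ-≤ m quotients<) ⟩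
    ρ + b / m * m        ≡⟨ b-split ⟨
    b                    ∎
    where
    open ≤-Reasoning
    ρ : ℕ
    ρ = a % m
    a-split : a ≡ ρ + a / m * m
    a-split = m≡m%n+[m/n]*n a m
    b-split : b ≡ ρ + b / m * m
    b-split = trans (m≡m%n+[m/n]*n b m) (cong (_+ b / m * m) (sym a≡b))
    quotients< : a / m < b / m
    quotients< = *-cancelʳ-< m (a / m) (b / m) (+-cancelˡ-< ρ _ _ (subst₂ _<_ a-split b-split a<b))

  ones-at-distinct-residues : ∀ i j → i % m ≢ j % m → 1 ≤ countOnes (g (i % m)) → 1 ≤ countOnes (g (j % m)) →
                              2 ≤ countOnes (nodeDivisors m t)
  ones-at-distinct-residues i j i≢j one₁ one₂ =
    ≤-trans (+-mono-≤ one₁ one₂) (countOnes-concatMap-∈₂ g (residue-∈ i) (residue-∈ j) i≢j)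

  q≡1⇒one : ∀ {e p} → g e ≡ p ∷ 1 ∷ [] → 1 ≤ countOnes (g e)
  q≡1⇒one {p = p} ge = subst (λ xs → 1 ≤ countOnes xs) (sym ge) (countOnes-p∷1 p)

  p≡1⇒one : ∀ {e q} → g e ≡ 1 ∷ q ∷ [] → 1 ≤ countOnes (g e)
  p≡1⇒one ge = subst (λ xs → 1 ≤ countOnes xs) (sym ge) (s≤s z≤n)

  q≡1-and-p≡1 : ∀ i j {p q} → g (i % m) ≡ p ∷ 1 ∷ [] → g (j % m) ≡ 1 ∷ q ∷ [] →
                2 ≤ countOnes (nodeDivisors m t)
  q≡1-and-p≡1 i j gi gj with i % m ≟ j % m
  ... | no i≢j = ones-at-distinct-residues i j i≢j (q≡1⇒one gi) (p≡1⇒one gj)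
  ... | yes i≡j with trans (sym gi) (trans (cong g i≡j) gj)
  ...   | refl = ≤-trans (subst (λ xs → 2 ≤ countOnes xs) (sym gi) ≤-refl) (countOnes-concatMap-∈ g (residue-∈ i))

  two-sig1⇒two-ones : ∀ {r r′} → r < r′ → r′ < r + m → Sig1 r → Sig1 r′ →
                      2 ≤ countOnes (nodeDivisors m t)
  two-sig1⇒two-ones {r} {r′} r<r′ r′<r+m sig1 sig1′ with sig1-node-divisor r sig1 | sig1-node-divisor r′ sig1′
  ... | inj₁ (_ , g₁) | inj₁ (_ , g₂) =
          ones-at-distinct-residues r r′ (distinct-residues r<r′ r′<r+m) (q≡1⇒one g₁) (q≡1⇒one g₂)
  ... | inj₂ (_ , g₁) | inj₂ (_ , g₂) =
          ones-at-distinct-residues (suc r) (suc r′) (distinct-residues (s≤s r<r′) (s≤s r′<r+m))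
            (p≡1⇒one g₁) (p≡1⇒one g₂)
  ... | inj₁ (_ , g₁) | inj₂ (_ , g₂) = q≡1-and-p≡1 r (suc r′) g₁ g₂
  ... | inj₂ (_ , g₁) | inj₁ (_ , g₂) = q≡1-and-p≡1 r′ (suc r) g₂ g₁

  second-sig1 : ∀ R → Sig1 R → ¬ ¬ 2 ≤ countOnes (nodeDivisors m t)
  second-sig1 R sig1-at-R fewer =
    UniqueSignatureOne.impossible n (λ d → t (d + R)) (λ d → steps (d + R)) shifted-periodic
      (λ d → terms-≥2 (d + R)) sig1-at-R
      (λ d 0<d d<m sig1 → fewer (two-sig1⇒two-ones (m<n+m R 0<d) (d+R<R+m d<m) sig1-at-R sig1))
    where
    shifted-periodic : ∀ d → t (d + m + R) ≡ t (d + R)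
    shifted-periodic d = trans (cong t (trans (+-assoc d m R) (trans (cong (d +_) (+-comm m R)) (sym (+-assoc d R m)))))
                               (periodic (d + R))
    d+R<R+m : ∀ {d} → d < m → d + R < R + m
    d+R<R+m {d} d<m = subst (_< R + m) (+-comm R d) (+-monoʳ-< R d<m)

  two-ones : 2 ≤ countOnes (nodeDivisors m t)
  two-ones = decidable-stable (2 ≤? countOnes (nodeDivisors m t))
    (second-sig1 (proj₁ maximal-output) (maximal-output⇒sig1 (proj₁ maximal-output) (proj₂ maximal-output)))

period-one-impossible : ∀ t → NontrivialCycle 1 t → ⊥
period-one-impossible t C with NontrivialCycle.notAllEq C
... | i , j , tᵢ≢tⱼ = tᵢ≢tⱼ (trans (constant i) (sym (constant j)))
  where
  constant : ∀ i → t i ≡ t 0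
  constant zero    = refl
  constant (suc i) = trans (cong t (+-comm 1 i)) (trans (NontrivialCycle.periodic C i) (constant i))

proposition11 : (m : ℕ) (t : ℕ → ℕ) → NontrivialCycle m t →
    2 ≤ countOnes (nodeDivisors m t)
proposition11 zero          t C = contradiction (NontrivialCycle.m-pos C) λ ()
proposition11 (suc zero)    t C = ⊥-elim (period-one-impossible t C)
proposition11 (suc (suc n)) t C = Cycle.two-ones n t C
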